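{- Let \(\mathcal U\) and \(\mathcal V\) be universes and \(X:\mathcal U\). There is an equivalence of types \[\Big(\Sigma_{S:X\to\Omega_{\mathcal U\sqcup\mathcal V}}\ \Sigma_{I:\mathcal V}\ (I\twoheadrightarrow \mathbb T(S))\Big)\ \simeq\ \Big(\Sigma_{I:\mathcal V}(I\to X)\Big),\] i.e. between \(\mathcal V\)-covered subsets \(X\to\Omega_{\mathcal U\sqcup\mathcal V}\) (with their covering data) and families \(I\to X\) with \(I:\mathcal V\).
   Context: Setting: intensional Martin-Löf type theory with universes (join \(\sqcup\)), function extensionality, propositional extensionality, propositional truncation \(\|\cdot\|\). \(\Omega_{\mathcal W}\) is the type of propositions in universe \(\mathcal W\); a subset of \(X\) is a map \(S:X\to\Omega_{\mathcal W}\). The total space of \(S\) is \(\mathbb T(S):=\Sigma_{x:X}S(x)\). A map \(e:A\to B\) is a surjection (\(A\twoheadrightarrow B\)) if every fibre is inhabited, i.e. \(\forall b,\ \|\Sigma_{a:A}e(a)=b\|\), and \(I\twoheadrightarrow B\) denotes the type of surjections. A subset \(S\) is \(\mathcal V\)-covered if it is given together with a type \(I:\mathcal V\) and a surjection \(e:I\twoheadrightarrow\mathbb T(S)\). -}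

module Defs where

open import Level using (Level; _⊔_; suc; Setω)
open import Data.Product using (Σ; _,_; proj₁; proj₂)
open import Relation.Binary.PropositionalEquality using (_≡_)
open import Axiom.Extensionality.Propositional using (Extensionality)

isProp : ∀ {ℓ} → Set ℓ → Set ℓ
isProp A = (x y : A) → x ≡ y

Ω : (𝓦 : Level) → Set (suc 𝓦)
Ω 𝓦 = Σ (Set 𝓦) isProp

PropExt : (ℓ : Level) → Set (suc ℓ)
PropExt ℓ = {P Q : Set ℓ} → isProp P → isProp Q → (P → Q) → (Q → P) → P ≡ Q

record PropTrunc : Setω where
  field
    ∥_∥       : ∀ {ℓ} → Set ℓ → Set ℓ
    ∥∥-isProp : ∀ {ℓ} {A : Set ℓ} → isProp ∥ A ∥
    ∣_∣       : ∀ {ℓ} {A : Set ℓ} → A → ∥ A ∥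
    ∥∥-rec    : ∀ {ℓ ℓ'} {A : Set ℓ} {P : Set ℓ'} → isProp P → (A → P) → ∥ A ∥ → P

record Assumptions : Setω where
  field
    funext  : ∀ {a b} → Extensionality a b
    propext : ∀ {ℓ} → PropExt ℓ
    trunc   : PropTrunc

module _ (PT : PropTrunc) where
  open PropTrunc PT

  𝕋 : ∀ {𝓤 𝓦} {X : Set 𝓤} → (X → Ω 𝓦) → Set (𝓤 ⊔ 𝓦)
  𝕋 {X = X} S = Σ X (λ x → proj₁ (S x))

  isSurjection : ∀ {a b} {A : Set a} {B : Set b} → (A → B) → Set (a ⊔ b)
  isSurjection {A = A} {B = B} e = (y : B) → ∥ Σ A (λ x → e x ≡ y) ∥

  _↠_ : ∀ {a b} → Set a → Set b → Set (a ⊔ b)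
  A ↠ B = Σ (A → B) isSurjection

-- A covering e : I ↠ 𝕋 S forgets to the family proj₁ ∘ e : I → X, and a family f : I → X
-- is covered by its image x ↦ ∥ Σ i , f i ≡ x ∥ via the corestriction of f.  Forgetting the
-- image covering gives back f on the nose; conversely, surjectivity of e makes S coincide with
-- the image of proj₁ ∘ e, and the coverings then agree because being a surjection and the
-- fibres of S are propositions.
module Submission where

open import Defs
open import Level using (Level; _⊔_; suc)
open import Data.Product using (Σ; _,_; proj₁; proj₂)
open import Data.Product.Properties using (Σ-≡,≡→≡)
open import Function using (_∘_)
open import Function.Bundles using (mk↔ₛ′)
open import Function.Properties.Inverse.HalfAdjointEquivalence using (_≃_; ↔⇒≃)
open import Relation.Binary.PropositionalEquality using (_≡_; refl; cong; subst)
open import Axiom.UniquenessOfIdentityProofs.WithK using (uip)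

Σ-≡-prop : ∀ {a b} {A : Set a} {B : A → Set b} → (∀ x → isProp (B x))
  → {x x' : A} {u : B x} {u' : B x'} → x ≡ x' → (x , u) ≡ (x' , u')
Σ-≡-prop B-prop {x' = x'} {u' = u'} p = Σ-≡,≡→≡ (p , B-prop x' _ u')

module CoveredSubsets (A : Assumptions) where
  open Assumptions A
  open PropTrunc trunc

  CoveredSubset : ∀ {𝓤} (𝓥 : Level) → Set 𝓤 → Set (suc (𝓤 ⊔ 𝓥))
  CoveredSubset {𝓤} 𝓥 X = Σ (X → Ω (𝓤 ⊔ 𝓥)) (λ S → Σ (Set 𝓥) (λ I → _↠_ trunc I (𝕋 trunc S)))

  Family : ∀ {𝓤} (𝓥 : Level) → Set 𝓤 → Set (𝓤 ⊔ suc 𝓥)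
  Family 𝓥 X = Σ (Set 𝓥) (λ I → I → X)

  isProp-isProp : ∀ {ℓ} (P : Set ℓ) → isProp (isProp P)
  isProp-isProp P p q = funext λ x → funext λ y → uip (p x y) (q x y)

  isProp-isSurjection : ∀ {a b} {I : Set a} {B : Set b} (e : I → B) → isProp (isSurjection trunc e)
  isProp-isSurjection e s s' = funext λ y → ∥∥-isProp (s y) (s' y)

  Ω-≡ : ∀ {ℓ} {P Q : Ω ℓ} → (proj₁ P → proj₁ Q) → (proj₁ Q → proj₁ P) → P ≡ Q
  Ω-≡ {P = P} {Q} f g = Σ-≡-prop isProp-isProp (propext (proj₂ P) (proj₂ Q) f g)

  module _ {𝓤 𝓥 : Level} {X : Set 𝓤} {I : Set 𝓥} where

    image : (I → X) → X → Ω (𝓤 ⊔ 𝓥)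
    image f x = ∥ Σ I (λ i → f i ≡ x) ∥ , ∥∥-isProp

    corestriction : (f : I → X) → _↠_ trunc I (𝕋 trunc (image f))
    corestriction f = (λ i → f i , ∣ i , refl ∣)
                    , λ (x , t) → ∥∥-rec ∥∥-isProp
                        (λ (i , p) → ∣ i , Σ-≡-prop (λ _ → ∥∥-isProp) p ∣) t

    image-of-cover : (S : X → Ω (𝓤 ⊔ 𝓥)) (e : _↠_ trunc I (𝕋 trunc S))
      → image (proj₁ ∘ proj₁ e) ≡ S
    image-of-cover S (e , e-surj) = funext λ x → Ω-≡
      (∥∥-rec (proj₂ (S x)) (λ (i , p) → subst (proj₁ ∘ S) p (proj₂ (e i))))
      (λ s → ∥∥-rec ∥∥-isProp (λ (i , p) → ∣ i , cong proj₁ p ∣) (e-surj (x , s)))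

    ↠-≡ : {S : X → Ω (𝓤 ⊔ 𝓥)} (e e' : _↠_ trunc I (𝕋 trunc S))
      → (∀ i → proj₁ (proj₁ e i) ≡ proj₁ (proj₁ e' i)) → e ≡ e'
    ↠-≡ {S} (e , _) (e' , _) p = Σ-≡-prop isProp-isSurjection
      (funext λ i → Σ-≡-prop (proj₂ ∘ S) (p i))

    CoveredSubset-≡ : {S S' : X → Ω (𝓤 ⊔ 𝓥)} → S ≡ S'
      → (e : _↠_ trunc I (𝕋 trunc S)) (e' : _↠_ trunc I (𝕋 trunc S'))
      → (∀ i → proj₁ (proj₁ e i) ≡ proj₁ (proj₁ e' i))
      → _≡_ {A = CoveredSubset 𝓥 X} (S , I , e) (S' , I , e')
    CoveredSubset-≡ {S} refl e e' p = cong {B = CoveredSubset 𝓥 X} (λ e → S , I , e) (↠-≡ {S} e e' p)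

  module _ {𝓤 𝓥 : Level} {X : Set 𝓤} where

    underlyingFamily : CoveredSubset 𝓥 X → Family 𝓥 X
    underlyingFamily (S , I , e , _) = I , proj₁ ∘ e

    imageCovering : Family 𝓥 X → CoveredSubset 𝓥 X
    imageCovering (I , f) = image f , I , corestriction f

    imageCovering-underlyingFamily : ∀ c → imageCovering (underlyingFamily c) ≡ c
    imageCovering-underlyingFamily (S , I , e) =
      CoveredSubset-≡ (image-of-cover S e) (corestriction (proj₁ ∘ proj₁ e)) e (λ _ → refl)

theorem5p6 : (A : Assumptions) (𝓤 𝓥 : Level) (X : Set 𝓤)
    → (Σ (X → Ω (𝓤 ⊔ 𝓥)) (λ S → Σ (Set 𝓥) (λ I → _↠_ (Assumptions.trunc A) I (𝕋 (Assumptions.trunc A) S))))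
      ≃ (Σ (Set 𝓥) (λ I → I → X))
theorem5p6 A 𝓤 𝓥 X =
  ↔⇒≃ (mk↔ₛ′ underlyingFamily imageCovering (λ _ → refl) imageCovering-underlyingFamily)
  where open CoveredSubsets A
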